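{- Let $\sigma:E_1\to E_2$ be an $\mathcal L$-map, $\sigma_{\mathcal L}:\mathbb P_oE_1\to\mathbb P_oE_2$ its induced map on extended projective spaces, and $P_o:E_i\to\mathbb P_oE_i$ the extended projectivization map. Then $P_o\circ\sigma=\sigma_{\mathcal L}\circ P_o$.
   Context: $E_1,E_2$ are finite-dimensional vector spaces over $\mathbb F_q$. An $\mathcal L$-map $\sigma:E_1\to E_2$ is a (not necessarily linear) function such that $\sigma(V)$ is a subspace of $E_2$ for every subspace $V\le E_1$. $\mathbb PE$ is the set of $1$-dimensional subspaces of $E$ and $\mathbb P_oE=\mathbb PE\cup\{o\}$ for a new symbol $o$. The extended projectivization map $P_o:E\to\mathbb P_oE$ sends $0\mapsto o$ and $v\mapsto\langle v\rangle$ for $v\ne0$. Identifying the zero subspace with $o$, $\sigma_{\mathcal L}$ is the restriction of $V\mapsto\sigma(V)$ to $\{0\}$ and the $1$-dimensional subspaces: $\sigma_{\mathcal L}(o)=o$, and for a line $\ell$, $\sigma_{\mathcal L}(\ell)=\sigma(\ell)$ if this is a line and $o$ if $\sigma(\ell)=\{0\}$. -}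

module Defs where

open import Level using (0ℓ)
open import Data.Nat using (ℕ)
open import Data.Fin using (Fin)
open import Data.Vec using (Vec; replicate; zipWith; map)
open import Data.Product using (Σ; _×_; ∃; _,_)
open import Relation.Nullary using (¬_)
open import Relation.Unary using (Pred; _∈_; _≐_)
open import Relation.Binary.PropositionalEquality using (_≡_)
open import Algebra.Structures using (IsCommutativeRing)
open import Function.Bundles using (_↔_)

record FiniteField (q : ℕ) : Set₁ where
  field
    Carrier : Set
    _+_ _*_ : Carrier → Carrier → Carrier
    -_      : Carrier → Carrier
    0# 1#   : Carrier
    isCommutativeRing : IsCommutativeRing _≡_ _+_ _*_ -_ 0# 1#
    0≢1     : ¬ (0# ≡ 1#)
    inverse : ∀ x → ¬ (x ≡ 0#) → Σ Carrier (λ y → x * y ≡ 1#)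
    finite  : Carrier ↔ Fin q

module VectorSpaces {q : ℕ} (𝔽 : FiniteField q) where
  open FiniteField 𝔽

  -- The n-dimensional vector space F_q^n (every finite-dimensional
  -- F_q-vector space is isomorphic to one of these).
  E : ℕ → Set
  E n = Vec Carrier n

  0v : ∀ {n} → E n
  0v = replicate _ 0#

  _+v_ : ∀ {n} → E n → E n → E n
  _+v_ = zipWith _+_

  _·_ : ∀ {n} → Carrier → E n → E n
  a · v = map (a *_) v

  Subset : ℕ → Set₁
  Subset n = Pred (E n) 0ℓ

  record IsSubspace {n : ℕ} (V : Subset n) : Set where
    field
      zero∈ : 0v ∈ V
      +-closed : ∀ {u w} → u ∈ V → w ∈ V → (u +v w) ∈ V
      ·-closed : ∀ a {u} → u ∈ V → (a · u) ∈ V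

  image : ∀ {n m} → (E n → E m) → Subset n → Subset m
  image σ V w = ∃ λ v → v ∈ V × σ v ≡ w

  IsLMap : ∀ {n m} → (E n → E m) → Set₁
  IsLMap {n} σ = (V : Subset n) → IsSubspace V → IsSubspace (image σ V)

  span : ∀ {n} → E n → Subset n
  span v w = ∃ λ a → w ≡ a · v

  -- Extended projective space ℙ_o E: its points are the zero subspace
  -- (playing the role of o) and the lines of E; we represent a point by the
  -- subspace itself, with equality of points being equality of subsets (_≐_).
  Pₒ : ∀ {n} → E n → Subset n
  Pₒ v = span v

  -- The induced map σ_𝓛 : V ↦ σ(V), applied to points of ℙ_o E
  -- (σ_𝓛(o) = σ({0}) = {σ 0}, which is {0} since σ({0}) is a subspace).
  σ𝓛 : ∀ {n m} → (E n → E m) → Subset n → Subset m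
  σ𝓛 σ V = image σ V

{-# OPTIONS --safe #-}
module Submission where

-- σ⟨v⟩ = {σ (c v) | c ∈ 𝔽} has at most q points and is a subspace containing σ v,
-- so it contains ⟨σ v⟩. A further point y ∉ ⟨σ v⟩ is impossible: if σ v ≠ 0 the
-- points a σv + y (a ∈ 𝔽) and σ v are q + 1 distinct points of σ⟨v⟩; if σ v = 0,
-- then y ≠ 0 and ⟨y⟩ ⊆ σ⟨v⟩ already has q points, while c ↦ σ (c v) is not
-- injective, since it vanishes at c = 0 and c = 1. Both contradict the pigeonhole
-- principle, used as: an injective endomap of a finite set misses no point.

open import Defs
open import Level using (0ℓ)
open import Data.Nat using (ℕ; zero; suc)
open import Data.Nat.Properties using (1+n≰n)
open import Data.Fin using (Fin; zero; suc)
open import Data.Fin.Properties using (injective⇒≤; any?; inj⇒≟)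
open import Data.Vec using ([]; _∷_)
open import Data.Vec.Properties using (∷-injectiveˡ; ∷-injectiveʳ; ≡-dec)
open import Data.Product using (∃; _,_; proj₁; proj₂)
open import Data.Empty using (⊥-elim)
open import Function using (_∘_; _↔_; Inverse; Injection)
open import Function.Definitions using (Injective)
open import Function.Properties.Inverse using (↔⇒↣)
open import Relation.Nullary using (¬_; Dec; yes; no)
open import Relation.Nullary.Decidable using (decidable-stable)
open import Relation.Unary using (_∈_; _∉_; _≐_)
open import Relation.Binary.Definitions using (DecidableEquality)
open import Relation.Binary.PropositionalEquality
open import Algebra.Bundles using (CommutativeRing)
import Algebra.Properties.Ring as RingProperties
import Algebra.Properties.Group as GroupProperties

module _ {A : Set} {q : ℕ} (A↔Fin : A ↔ Fin q) where
  open Inverse A↔Fin using (to; from; strictlyInverseˡ)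

  private
    to-injective : Injective _≡_ _≡_ to
    to-injective = Injection.injective (↔⇒↣ A↔Fin)

    from-injective : Injective _≡_ _≡_ from
    from-injective {i} {j} eq =
      trans (sym (strictlyInverseˡ i)) (trans (cong to eq) (strictlyInverseˡ j))

  injective-endomap-hits : (k : A → A) → Injective _≡_ _≡_ k →
                           ∀ c → ¬ (∀ a → k a ≢ c)
  injective-endomap-hits k k-injective c c-missed =
    1+n≰n (injective⇒≤ {f = to ∘ e} (e-injective ∘ to-injective))
    where
    e : Fin (suc q) → A
    e zero    = c
    e (suc i) = k (from i)

    e-injective : Injective _≡_ _≡_ e
    e-injective {zero}  {zero}  _  = refl
    e-injective {zero}  {suc j} eq = ⊥-elim (c-missed (from j) (sym eq))
    e-injective {suc i} {zero}  eq = ⊥-elim (c-missed (from i) eq)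
    e-injective {suc i} {suc j} eq = cong suc (from-injective (k-injective eq))

  module _ {B : Set} (f g : A → B) (g-injective : Injective _≡_ _≡_ g)
           (image-g⊆image-f : ∀ a → ∃ λ c → f c ≡ g a) where
    private
      k : A → A
      k a = proj₁ (image-g⊆image-f a)

      f∘k≗g : ∀ a → f (k a) ≡ g a
      f∘k≗g a = proj₂ (image-g⊆image-f a)

      k-injective : Injective _≡_ _≡_ k
      k-injective {a} {b} eq =
        g-injective (trans (sym (f∘k≗g a)) (trans (cong f eq) (f∘k≗g b)))

    image-f⊆image-g : ∀ c → ¬ (∀ a → g a ≢ f c)
    image-f⊆image-g c g-misses = injective-endomap-hits k k-injective c
      λ a ka≡c → g-misses a (trans (sym (f∘k≗g a)) (cong f ka≡c))

    f-injective : ∀ {c₀ c₁} → f c₀ ≡ f c₁ → ¬ c₀ ≢ c₁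
    f-injective {c₀} {c₁} eq c₀≢c₁ =
      injective-endomap-hits k k-injective c₀ λ a₀ ka₀≡c₀ →
      injective-endomap-hits k k-injective c₁ λ a₁ ka₁≡c₁ →
      c₀≢c₁ (begin
        c₀      ≡⟨ sym ka₀≡c₀ ⟩
        k a₀    ≡⟨ cong k (g-injective (begin
                     g a₀      ≡⟨ sym (f∘k≗g a₀) ⟩
                     f (k a₀)  ≡⟨ cong f ka₀≡c₀ ⟩
                     f c₀      ≡⟨ eq ⟩
                     f c₁      ≡⟨ cong f (sym ka₁≡c₁) ⟩
                     f (k a₁)  ≡⟨ f∘k≗g a₁ ⟩
                     g a₁      ∎)) ⟩
        k a₁    ≡⟨ ka₁≡c₁ ⟩
        c₁      ∎)
      where open ≡-Reasoning

module _ {q : ℕ} (𝔽 : FiniteField q) where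
  open FiniteField 𝔽
  open VectorSpaces 𝔽

  private
    R : CommutativeRing 0ℓ 0ℓ
    R = record { isCommutativeRing = isCommutativeRing }
    open CommutativeRing R using (ring; +-group; _-_; +-comm; +-identityˡ;
      zeroˡ; zeroʳ; *-identityˡ; *-assoc; *-comm; distribʳ)
    open RingProperties ring using ([y-z]x≈yx-zx)
    open GroupProperties +-group using (x∙y⁻¹≈ε⇒x≈y; x≈y⇒x∙y⁻¹≈ε;
      ∙-cancelˡ; ∙-cancelʳ; //-rightDividesˡ)
    open Inverse finite using (to; from; strictlyInverseʳ)

  _≟_ : DecidableEquality Carrier
  _≟_ = inj⇒≟ (↔⇒↣ finite)

  _≟v_ : ∀ {n} → DecidableEquality (E n)
  _≟v_ = ≡-dec _≟_

  ·-zeroˡ : ∀ {n} (w : E n) → 0# · w ≡ 0v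
  ·-zeroˡ []      = refl
  ·-zeroˡ (x ∷ w) = cong₂ _∷_ (zeroˡ x) (·-zeroˡ w)

  ·-zeroʳ : ∀ {n} a → a · 0v {n} ≡ 0v
  ·-zeroʳ {zero}  a = refl
  ·-zeroʳ {suc n} a = cong₂ _∷_ (zeroʳ a) (·-zeroʳ a)

  ·-identityˡ : ∀ {n} (w : E n) → 1# · w ≡ w
  ·-identityˡ []      = refl
  ·-identityˡ (x ∷ w) = cong₂ _∷_ (*-identityˡ x) (·-identityˡ w)

  ·-assoc : ∀ {n} a b (w : E n) → a · (b · w) ≡ (a * b) · w
  ·-assoc a b []      = refl
  ·-assoc a b (x ∷ w) = cong₂ _∷_ (sym (*-assoc a b x)) (·-assoc a b w)

  ·-distribʳ : ∀ {n} a b (w : E n) → (a · w) +v (b · w) ≡ (a + b) · w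
  ·-distribʳ a b []      = refl
  ·-distribʳ a b (x ∷ w) = cong₂ _∷_ (sym (distribʳ x a b)) (·-distribʳ a b w)

  +v-identityˡ : ∀ {n} (w : E n) → 0v +v w ≡ w
  +v-identityˡ []      = refl
  +v-identityˡ (x ∷ w) = cong₂ _∷_ (+-identityˡ x) (+v-identityˡ w)

  +v-cancelˡ : ∀ {n} (w x y : E n) → w +v x ≡ w +v y → x ≡ y
  +v-cancelˡ []      []      []      _  = refl
  +v-cancelˡ (c ∷ w) (a ∷ x) (b ∷ y) eq =
    cong₂ _∷_ (∙-cancelˡ c a b (∷-injectiveˡ eq)) (+v-cancelˡ w x y (∷-injectiveʳ eq))

  +v-cancelʳ : ∀ {n} (w x y : E n) → x +v w ≡ y +v w → x ≡ y
  +v-cancelʳ []      []      []      _  = refl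
  +v-cancelʳ (c ∷ w) (a ∷ x) (b ∷ y) eq =
    cong₂ _∷_ (∙-cancelʳ c a b (∷-injectiveˡ eq)) (+v-cancelʳ w x y (∷-injectiveʳ eq))

  au≡bu⇒[a-b]u≡0 : ∀ {n} a b (u : E n) → a · u ≡ b · u → (a - b) · u ≡ 0v
  au≡bu⇒[a-b]u≡0 a b []      _  = refl
  au≡bu⇒[a-b]u≡0 a b (x ∷ u) eq = cong₂ _∷_
    (trans ([y-z]x≈yx-zx x a b) (x≈y⇒x∙y⁻¹≈ε (∷-injectiveˡ eq)))
    (au≡bu⇒[a-b]u≡0 a b u (∷-injectiveʳ eq))

  au≡0⇒u≡0 : ∀ {n} a (u : E n) → a ≢ 0# → a · u ≡ 0v → u ≡ 0v
  au≡0⇒u≡0 a u a≢0 au≡0 with b , ab≡1 ← inverse a a≢0 = begin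
    u            ≡⟨ sym (·-identityˡ u) ⟩
    1# · u       ≡⟨ cong (_· u) (trans (sym ab≡1) (*-comm a b)) ⟩
    (b * a) · u  ≡⟨ sym (·-assoc b a u) ⟩
    b · (a · u)  ≡⟨ cong (b ·_) au≡0 ⟩
    b · 0v       ≡⟨ ·-zeroʳ b ⟩
    0v           ∎
    where open ≡-Reasoning

  ·-cancelʳ : ∀ {n} a b (w : E n) → w ≢ 0v → a · w ≡ b · w → a ≡ b
  ·-cancelʳ a b w w≢0 eq with (a - b) ≟ 0#
  ... | yes a-b≡0 = x∙y⁻¹≈ε⇒x≈y a b a-b≡0
  ... | no  a-b≢0 = ⊥-elim (w≢0 (au≡0⇒u≡0 (a - b) w a-b≢0 (au≡bu⇒[a-b]u≡0 a b w eq)))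

  au+w≡u⇒w≡[1-a]u : ∀ {n} a (u w : E n) → (a · u) +v w ≡ u → w ≡ (1# - a) · u
  au+w≡u⇒w≡[1-a]u a u w eq = +v-cancelˡ (a · u) w ((1# - a) · u) (begin
    (a · u) +v w                ≡⟨ eq ⟩
    u                           ≡⟨ sym (·-identityˡ u) ⟩
    1# · u                      ≡⟨ cong (_· u) (trans (sym (//-rightDividesˡ a 1#)) (+-comm (1# - a) a)) ⟩
    (a + (1# - a)) · u          ≡⟨ sym (·-distribʳ a (1# - a) u) ⟩
    (a · u) +v ((1# - a) · u)   ∎)
    where open ≡-Reasoning

  span? : ∀ {n} (u w : E n) → Dec (w ∈ span u)
  span? u w with any? (λ i → w ≟v (from i · u))
  ... | yes (i , w≡iu) = yes (from i , w≡iu)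
  ... | no  ∄i         = no λ (a , w≡au) →
    ∄i (to a , trans w≡au (cong (_· u) (sym (strictlyInverseʳ a))))

  span-isSubspace : ∀ {n} (v : E n) → IsSubspace (span v)
  span-isSubspace v = record
    { zero∈    = 0# , sym (·-zeroˡ v)
    ; +-closed = λ { (a , refl) (b , refl) → a + b , ·-distribʳ a b v }
    ; ·-closed = λ { c (a , refl) → c * a , ·-assoc c a v }
    }

  zero-isSubspace : ∀ {n} → IsSubspace {n} (_≡ 0v)
  zero-isSubspace = record
    { zero∈    = refl
    ; +-closed = λ { refl refl → +v-identityˡ 0v }
    ; ·-closed = λ { a refl → ·-zeroʳ a }
    }

  module _ {n m : ℕ} {σ : E n → E m} (σ-isLMap : IsLMap σ) where

    σ-zero : σ 0v ≡ 0v
    σ-zero with _ , refl , σ0≡0 ← IsSubspace.zero∈ (σ-isLMap (_≡ 0v) zero-isSubspace) = σ0≡0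

    module _ (v : E n) where
      open IsSubspace (σ-isLMap (span v) (span-isSubspace v))

      private
        f : Carrier → E m
        f c = σ (c · v)

        f-onto-image : ∀ {y} → y ∈ image σ (span v) → ∃ λ c → f c ≡ y
        f-onto-image (_ , (c , refl) , σ[cv]≡y) = c , σ[cv]≡y

        f-one : f 1# ≡ σ v
        f-one = cong σ (·-identityˡ v)

        σv∈image : σ v ∈ image σ (span v)
        σv∈image = v , (1# , sym (·-identityˡ v)) , refl

      span-image⊆image-span : ∀ {y} → y ∈ span (σ v) → y ∈ image σ (span v)
      span-image⊆image-span (a , refl) = ·-closed a σv∈image

      image-span⊆span-image-nonzero : σ v ≢ 0v → ∀ {y} → y ∈ image σ (span v) →
                                      ¬ y ∉ span (σ v)
      image-span⊆span-image-nonzero σv≢0 {y} y∈image y∉span =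
        image-f⊆image-g finite f g g-injective
          (λ a → f-onto-image (+-closed (·-closed a σv∈image) y∈image))
          1# λ a ga≡f1 → y∉span (1# - a , au+w≡u⇒w≡[1-a]u a (σ v) y (trans ga≡f1 f-one))
        where
        g : Carrier → E m
        g a = (a · σ v) +v y

        g-injective : Injective _≡_ _≡_ g
        g-injective {a} {b} eq = ·-cancelʳ a b (σ v) σv≢0 (+v-cancelʳ y _ _ eq)

      image-span⊆span-image-zero : σ v ≡ 0v → ∀ {y} → y ∈ image σ (span v) →
                                   ¬ y ∉ span (σ v)
      image-span⊆span-image-zero σv≡0 {y} y∈image y∉span =
        f-injective finite f g g-injective
          (λ b → f-onto-image (·-closed b y∈image))
          f-zero≡f-one 0≢1
        where
        y≢0 : y ≢ 0v
        y≢0 y≡0 = y∉span (0# , trans y≡0 (sym (trans (cong (0# ·_) σv≡0) (·-zeroʳ 0#))))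

        g : Carrier → E m
        g b = b · y

        g-injective : Injective _≡_ _≡_ g
        g-injective {a} {b} = ·-cancelʳ a b y y≢0

        f-zero≡f-one : f 0# ≡ f 1#
        f-zero≡f-one = trans (cong σ (·-zeroˡ v)) (trans σ-zero (sym (trans f-one σv≡0)))

      image-span⊆span-image : ∀ {y} → y ∈ image σ (span v) → y ∈ span (σ v)
      image-span⊆span-image {y} y∈image = decidable-stable (span? (σ v) y) ¬y∉span
        where
        ¬y∉span : ¬ y ∉ span (σ v)
        ¬y∉span with σ v ≟v 0v
        ... | yes σv≡0 = image-span⊆span-image-zero σv≡0 y∈image
        ... | no  σv≢0 = image-span⊆span-image-nonzero σv≢0 y∈image

proposition4p5 : {q : ℕ} (𝔽 : FiniteField q) → let open VectorSpaces 𝔽 in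
    (n m : ℕ) (σ : E n → E m) → IsLMap σ →
    (v : E n) → Pₒ (σ v) ≐ σ𝓛 σ (Pₒ v)
proposition4p5 𝔽 n m σ σ-isLMap v =
  span-image⊆image-span 𝔽 σ-isLMap v , image-span⊆span-image 𝔽 σ-isLMap v
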